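{- Let $k\ge1$ and let $\nu$ be a nonempty partition with $\nu\subset R_{k+1-l(\nu)}$. Let $u$ be an integer with $0\le u\le\nu_{l(\nu)}$, and let $p,n$ be integers. For $0\le u'\le u$ define $$T_{\nu,u',p}=\sum_{s=0}^{u'}(-1)^s\binom{p}{s}g^{(k)}_{\nu\cup(u'-s)},\qquad T'_{P,\nu,u',p}=\sum_{s=0}^{u'}(-1)^s\binom{p+\alpha_{u'+1-s}}{s}g^{(k)}_{P\cup\nu\cup(u'-s)},$$ where $P=R_{t_1}^{a_1}\cup\cdots\cup R_{t_m}^{a_m}$ with $m\ge1$, $1\le t_1,\dots,t_m\le k$ distinct integers, $a_1,\dots,a_m$ positive integers, and $\alpha_w=\#\{v:1\le v\le m,\ t_v\ge w\}$. Then (1) $\displaystyle\sum_{i=0}^{u}\binom{p+n+i-1}{i}T_{\nu,u-i,p}=\sum_{s=0}^{u}\binom{n+s-1}{s}g^{(k)}_{\nu\cup(u-s)}$; (2) $\displaystyle\sum_{i=0}^{u}\binom{p+n+i-1}{i}T'_{P,\nu,u-i,p}=\sum_{s=0}^{u}\binom{n-\alpha_{u+1-s}+s-1}{s}g^{(k)}_{P\cup\nu\cup(u-s)}$. In particular, in both cases the left-hand side does not depend on $p$.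
   Context: Partitions: $l(\lambda)$ is the number of nonzero parts; $\lambda\cup\mu$ is the partition whose multiset of parts is the union of those of $\lambda$ and $\mu$; $(s)$ is a one-part partition and $\lambda\cup(0)=\lambda$; $\subset$ is containment of Young diagrams. $\mathcal P^k$ is the set of partitions with $\lambda_1\le k$. For $1\le t\le k$, $R_t=(t^{k+1-t})$ and $R_t^a$ is the union of $a$ copies of $R_t$. $\binom ab=a(a-1)\cdots(a-b+1)/b!$ for $a\in\mathbb Z$, integer $b\ge0$, and $0$ for $b<0$. The $K$-$k$-Schur functions $g^{(k)}_\lambda$, $\lambda\in\mathcal P^k$, form a family of symmetric functions in $\Lambda^{(k)}=\mathbb Z[h_1,\dots,h_k]$ (the statement is a formal identity valid for any family of elements indexed by $\mathcal P^k$); they are characterized by $g^{(k)}_\emptyset=1$ and the Pieri rule $h_rg^{(k)}_\lambda=\sum_{s=0}^r(-1)^{r-s}\sum_{\mu}\binom{r_{\mathfrak c(\mu)\mathfrak c(\lambda)}}{r-s}g^{(k)}_\mu$ (sum over $\mu\in\mathcal P^k$ with $\mathfrak c(\mu)/\mathfrak c(\lambda)$ a weak $s$-strip, notation as in the theory of $(k+1)$-cores), but that characterization is not needed for this identity. -}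

module Defs where

open import Level using (Level)
open import Data.Nat as ℕ using (ℕ; zero; suc; _≤ᵇ_; _<_; _!)
open import Data.Nat.Properties using (_!≢0)
open import Data.Integer as ℤ using (ℤ; +_; -[1+_])
open import Data.Integer.DivMod using (_/ℕ_)
open import Data.List using (List; []; _∷_; length; replicate; foldr; map; filterᵇ; concatMap)
open import Data.List.Relation.Unary.All using (All)
open import Data.List.Relation.Unary.Linked using (Linked)
open import Data.List.Relation.Binary.Pointwise using (Pointwise)
open import Data.Product using (_×_; _,_; proj₁; proj₂)
open import Data.Bool using (if_then_else_)
open import Algebra.Bundles using (AbelianGroup)
import Algebra.Definitions.RawMonoid as RM

IsPartition : List ℕ → Set
IsPartition λ′ = All (0 <_) λ′ × Linked ℕ._≥_ λ′

-- l(λ) is `length λ`.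

lastPart : List ℕ → ℕ
lastPart []           = 0
lastPart (x ∷ [])     = x
lastPart (_ ∷ y ∷ ys) = lastPart (y ∷ ys)

firstPart : List ℕ → ℕ
firstPart []      = 0
firstPart (x ∷ _) = x

-- insert one part (parts equal to 0 are dropped, so λ ∪ (0) = λ)
insertPart : ℕ → List ℕ → List ℕ
insertPart zero    ys       = ys
insertPart (suc x) []       = suc x ∷ []
insertPart (suc x) (y ∷ ys) =
  if y ℕ.≤ᵇ x then suc x ∷ y ∷ ys else y ∷ insertPart (suc x) ys

_∪_ : List ℕ → List ℕ → List ℕ
λ′ ∪ μ = foldr insertPart λ′ μ

⟨_⟩ : ℕ → List ℕ
⟨ s ⟩ = s ∷ []

data _⊂_ : List ℕ → List ℕ → Set where
  []⊂  : ∀ {λ′} → [] ⊂ λ′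
  ∷⊂   : ∀ {x y xs ys} → x ℕ.≤ y → xs ⊂ ys → (x ∷ xs) ⊂ (y ∷ ys)

R : (k t : ℕ) → List ℕ
R k t = replicate (suc k ℕ.∸ t) t

Rpow : (k t a : ℕ) → List ℕ
Rpow k t zero    = []
Rpow k t (suc a) = Rpow k t a ∪ R k t

-- P = R_{t_1}^{a_1} ∪ ... ∪ R_{t_m}^{a_m}, given as the list of pairs (t_v , a_v)
Pof : (k : ℕ) → List (ℕ × ℕ) → List ℕ
Pof k []             = []
Pof k ((t , a) ∷ ts) = Rpow k t a ∪ Pof k ts

α : List (ℕ × ℕ) → ℕ → ℕ
α ts w = length (filterᵇ (λ ta → w ℕ.≤ᵇ proj₁ ta) ts)

falling : ℤ → ℕ → ℤ
falling a zero    = + 1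
falling a (suc b) = falling a b ℤ.* (a ℤ.- + b)

binom : ℤ → ℕ → ℤ
binom a b = (falling a b /ℕ (b !)) {{b !≢0}}

module InGroup {c ℓ : Level} (G : AbelianGroup c ℓ) where
  open AbelianGroup G

  _·_ : ℤ → Carrier → Carrier
  (+ n)    · x = RM._×_ rawMonoid n x
  -[1+ n ] · x = (RM._×_ rawMonoid (suc n) x) ⁻¹

  Σ₀ : ℕ → (ℕ → Carrier) → Carrier
  Σ₀ zero    f = f 0
  Σ₀ (suc u) f = Σ₀ u f ∙ f (suc u)

  sign : ℕ → ℤ
  sign zero    = + 1
  sign (suc s) = ℤ.- sign s

  T : (g : List ℕ → Carrier) → List ℕ → ℕ → ℤ → Carrier
  T g ν u′ p = Σ₀ u′ (λ s → (sign s ℤ.* binom p s) · g (ν ∪ ⟨ u′ ℕ.∸ s ⟩))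

  -- T'_{P,ν,u',p}   (ts encodes P and the α's)
  T′ : (g : List ℕ → Carrier) → ℕ → List (ℕ × ℕ) → List ℕ → ℕ → ℤ → Carrier
  T′ g k ts ν u′ p =
    Σ₀ u′ (λ s → (sign s ℤ.* binom (p ℤ.+ + α ts (suc u′ ℕ.∸ s)) s)
                   · g ((Pof k ts ∪ ν) ∪ ⟨ u′ ℕ.∸ s ⟩))

module Submission where

-- Writing both sides as sums of ℤ-multiples of h(u - m) (with h(j) the
-- generator g(ν ∪ (j)), resp. g(P ∪ ν ∪ (j))), the double sum on the left
-- collapses by the negative-binomial Vandermonde identity
--
--     Σ_{i ≤ m} C(a+i-1, i) · (-1)^{m-i} C(q, m-i)  =  C(a-q+m-1, m),
--
-- i.e. the coefficient of x^m in (1-x)^{-a} (1-x)^q = (1-x)^{-(a-q)}.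

open import Defs
open import Data.Nat as ℕ using (ℕ; zero; suc; _∸_; _!)
open import Data.Nat.Properties using (_!≢0)
import Data.Nat.Properties as ℕP
open import Data.Integer as ℤ using (ℤ; +_; -[1+_])
import Data.Integer.Properties as ℤP
open import Data.Integer.DivMod using (_/ℕ_; [n/ℕd]*d≤n; n<s[n/ℕd]*d)
open import Data.Integer.Divisibility.Signed
  using (_∣_; divides; *-monoʳ-∣; ∣m∣n⇒∣m+n; ∣m+n∣n⇒∣m)
open import Data.Integer.Tactic.RingSolver using (solve-∀)
open import Data.List using (List; length; map)
open import Data.List.Relation.Unary.All using (All)
open import Data.List.Relation.Unary.Unique.Propositional using (Unique)
open import Data.Product using (_×_; _,_; proj₁; proj₂)
open import Algebra.Bundles using (AbelianGroup)
import Algebra.Definitions.RawMonoid as RawMonoid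
import Algebra.Properties.Monoid.Mult as MonoidMult
import Algebra.Properties.CommutativeMonoid.Mult as CommutativeMonoidMult
import Algebra.Properties.AbelianGroup as AbelianGroupProperties
import Algebra.Properties.Group as GroupProperties
import Algebra.Properties.CommutativeSemigroup as CommutativeSemigroupProperties
import Relation.Binary.Reasoning.Setoid as SetoidReasoning
open import Relation.Binary.PropositionalEquality as ≡
  using (_≡_; cong; cong₂)

∸-∸-cancel : ∀ u {m i} → i ℕ.≤ m → u ∸ i ∸ (m ∸ i) ≡ u ∸ m
∸-∸-cancel u {m} {i} i≤m =
  ≡.trans (ℕP.∸-+-assoc u i (m ∸ i)) (cong (u ∸_) (ℕP.m+[n∸m]≡n i≤m))

module Binomial where
  open ≡ using (refl)
  open ≡.≡-Reasoning

  ℤ-induction : (P : ℤ → Set) → P (+ 0) →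
                (∀ x → P x → P (ℤ.suc x)) → (∀ x → P (ℤ.suc x) → P x) →
                ∀ x → P x
  ℤ-induction P base up down (+ zero)       = base
  ℤ-induction P base up down (+ suc n)      = up (+ n) (ℤ-induction P base up down (+ n))
  ℤ-induction P base up down -[1+ zero ]    = down -[1+ zero ] base
  ℤ-induction P base up down -[1+ suc n ]   =
    down -[1+ suc n ] (ℤ-induction P base up down -[1+ n ])

  /ℕ-exact : ∀ q d .{{_ : ℕ.NonZero d}} → (q ℤ.* + d) /ℕ d ≡ q
  /ℕ-exact q (suc d) = ℤP.≤-antisym r≤q q≤r
    where
    r = (q ℤ.* + suc d) /ℕ suc d
    r≤q : r ℤ.≤ q
    r≤q = ℤP.*-cancelʳ-≤-pos r q (+ suc d) ([n/ℕd]*d≤n (q ℤ.* + suc d) (suc d))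
    q<1+r : q ℤ.< ℤ.suc r
    q<1+r = ℤP.*-cancelʳ-<-nonNeg (+ suc d) (n<s[n/ℕd]*d (q ℤ.* + suc d) (suc d))
    q≤r : q ℤ.≤ r
    q≤r = ≡.subst (q ℤ.≤_) (ℤP.pred-suc r) (ℤP.i<j⇒i≤pred[j] q<1+r)

  falling-shift : ∀ x b → falling (ℤ.suc x) (suc b) ≡ ℤ.suc x ℤ.* falling x b
  falling-shift x zero    = ring x
    where
    ring : ∀ x → + 1 ℤ.* ((+ 1 ℤ.+ x) ℤ.- + 0) ≡ (+ 1 ℤ.+ x) ℤ.* + 1
    ring = solve-∀
  falling-shift x (suc b) =
    ≡.trans (cong (ℤ._* (ℤ.suc x ℤ.- + suc b)) (falling-shift x b))
            (ring x (falling x b) (+ b))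
    where
    ring : ∀ x f y → ((+ 1 ℤ.+ x) ℤ.* f) ℤ.* ((+ 1 ℤ.+ x) ℤ.- (+ 1 ℤ.+ y))
                     ≡ (+ 1 ℤ.+ x) ℤ.* (f ℤ.* (x ℤ.- y))
    ring = solve-∀

  falling-pascal : ∀ x b →
    falling (ℤ.suc x) (suc b) ≡ falling x (suc b) ℤ.+ + suc b ℤ.* falling x b
  falling-pascal x b = ≡.trans (falling-shift x b) (ring x (falling x b) (+ b))
    where
    ring : ∀ x f y → (+ 1 ℤ.+ x) ℤ.* f ≡ f ℤ.* (x ℤ.- y) ℤ.+ (+ 1 ℤ.+ y) ℤ.* f
    ring = solve-∀

  falling-zero : ∀ b → falling (+ 0) (suc b) ≡ + 0
  falling-zero zero    = refl
  falling-zero (suc b) = cong (ℤ._* (+ 0 ℤ.- + suc b)) (falling-zero b)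

  factorial-suc : ∀ b → + (suc b !) ≡ + suc b ℤ.* + (b !)
  factorial-suc b = ℤP.pos-* (suc b) (b !)

  -- b! divides (x)_b for every integer x; this is what makes binom exact.
  factorial-∣-falling : ∀ b x → + (b !) ∣ falling x b
  factorial-∣-falling zero    x = divides (+ 1) refl
  factorial-∣-falling (suc b) = ℤ-induction (λ x → + (suc b !) ∣ falling x (suc b))
    (divides (+ 0) (falling-zero b)) up down
    where
    b!-term : ∀ x → + (suc b !) ∣ + suc b ℤ.* falling x b
    b!-term x = ≡.subst (_∣ + suc b ℤ.* falling x b) (≡.sym (factorial-suc b))
                        (*-monoʳ-∣ (+ suc b) (factorial-∣-falling b x))
    up : ∀ x → + (suc b !) ∣ falling x (suc b) → + (suc b !) ∣ falling (ℤ.suc x) (suc b)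
    up x ∣falling = ≡.subst (_ ∣_) (≡.sym (falling-pascal x b))
                            (∣m∣n⇒∣m+n ∣falling (b!-term x))
    down : ∀ x → + (suc b !) ∣ falling (ℤ.suc x) (suc b) → + (suc b !) ∣ falling x (suc b)
    down x ∣falling = ∣m+n∣n⇒∣m (≡.subst (_ ∣_) (falling-pascal x b) ∣falling) (b!-term x)

  falling≡binom*factorial : ∀ x b → falling x b ≡ binom x b ℤ.* + (b !)
  falling≡binom*factorial x b with factorial-∣-falling b x
  ... | divides q falling≡q*b! =
    ≡.trans falling≡q*b! (cong (ℤ._* + (b !)) (≡.sym binom≡q))
    where
    binom≡q : binom x b ≡ q
    binom≡q = ≡.trans (cong (λ z → (z /ℕ (b !)) {{b !≢0}}) falling≡q*b!)
                      (/ℕ-exact q (b !) {{b !≢0}})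

  binom-pascal : ∀ x b → binom (ℤ.suc x) (suc b) ≡ binom x (suc b) ℤ.+ binom x b
  binom-pascal x b = ℤP.*-cancelʳ-≡ _ _ (+ (suc b !)) {{suc b !≢0}} (begin
    binom (ℤ.suc x) (suc b) ℤ.* + (suc b !)
      ≡⟨ ≡.sym (falling≡binom*factorial (ℤ.suc x) (suc b)) ⟩
    falling (ℤ.suc x) (suc b)
      ≡⟨ falling-pascal x b ⟩
    falling x (suc b) ℤ.+ + suc b ℤ.* falling x b
      ≡⟨ cong₂ (λ y z → y ℤ.+ + suc b ℤ.* z)
               (≡.trans (falling≡binom*factorial x (suc b))
                        (cong (binom x (suc b) ℤ.*_) (factorial-suc b)))
               (falling≡binom*factorial x b) ⟩
    binom x (suc b) ℤ.* (+ suc b ℤ.* + (b !)) ℤ.+ + suc b ℤ.* (binom x b ℤ.* + (b !))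
      ≡⟨ ring (binom x (suc b)) (binom x b) (+ (b !)) (+ suc b) ⟩
    (binom x (suc b) ℤ.+ binom x b) ℤ.* (+ suc b ℤ.* + (b !))
      ≡⟨ cong ((binom x (suc b) ℤ.+ binom x b) ℤ.*_) (≡.sym (factorial-suc b)) ⟩
    (binom x (suc b) ℤ.+ binom x b) ℤ.* + (suc b !) ∎)
    where
    ring : ∀ A B F s → A ℤ.* (s ℤ.* F) ℤ.+ s ℤ.* (B ℤ.* F) ≡ (A ℤ.+ B) ℤ.* (s ℤ.* F)
    ring = solve-∀

  binom-zero : ∀ b → binom (+ 0) (suc b) ≡ + 0
  binom-zero b = ℤP.*-cancelʳ-≡ _ _ (+ (suc b !)) {{suc b !≢0}}
    (≡.trans (≡.sym (falling≡binom*factorial (+ 0) (suc b))) (falling-zero b))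

module Sums {c ℓ} (G : AbelianGroup c ℓ) where
  open AbelianGroup G
  open InGroup G using (Σ₀)
  open SetoidReasoning setoid
  private module CS = CommutativeSemigroupProperties commutativeSemigroup

  Σ-cong : ∀ u {f g : ℕ → Carrier} → (∀ i → i ℕ.≤ u → f i ≈ g i) → Σ₀ u f ≈ Σ₀ u g
  Σ-cong zero    f≈g = f≈g 0 ℕ.z≤n
  Σ-cong (suc u) f≈g =
    ∙-cong (Σ-cong u (λ i i≤u → f≈g i (ℕP.m≤n⇒m≤1+n i≤u))) (f≈g (suc u) ℕP.≤-refl)

  Σ-∙ : ∀ u (f g : ℕ → Carrier) → Σ₀ u (λ i → f i ∙ g i) ≈ Σ₀ u f ∙ Σ₀ u g
  Σ-∙ zero    f g = refl
  Σ-∙ (suc u) f g = trans (∙-congʳ (Σ-∙ u f g)) (CS.interchange _ _ _ _)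

  Σ-ε : ∀ u {f : ℕ → Carrier} → (∀ i → i ℕ.≤ u → f i ≈ ε) → Σ₀ u f ≈ ε
  Σ-ε zero    f≈ε = f≈ε 0 ℕ.z≤n
  Σ-ε (suc u) f≈ε = trans (∙-cong (Σ-ε u (λ i i≤u → f≈ε i (ℕP.m≤n⇒m≤1+n i≤u)))
                                  (f≈ε (suc u) ℕP.≤-refl))
                          (identityˡ ε)

  Σ-antidiagonal : ∀ u (F : ℕ → ℕ → Carrier) →
    Σ₀ u (λ i → Σ₀ (u ∸ i) (F i)) ≈ Σ₀ u (λ m → Σ₀ m (λ i → F i (m ∸ i)))
  Σ-antidiagonal zero    F = refl
  Σ-antidiagonal (suc u) F rewrite ℕP.n∸n≡0 u = begin
    Σ₀ u (λ i → Σ₀ (suc u ∸ i) (F i)) ∙ F (suc u) 0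
      ≈⟨ ∙-congʳ (Σ-cong u (λ i i≤u → reflexive (cong (λ j → Σ₀ j (F i)) (ℕP.+-∸-assoc 1 i≤u)))) ⟩
    Σ₀ u (λ i → Σ₀ (u ∸ i) (F i) ∙ F i (suc (u ∸ i))) ∙ F (suc u) 0
      ≈⟨ ∙-congʳ (Σ-∙ u _ _) ⟩
    (Σ₀ u (λ i → Σ₀ (u ∸ i) (F i)) ∙ Σ₀ u (λ i → F i (suc (u ∸ i)))) ∙ F (suc u) 0
      ≈⟨ ∙-congʳ (∙-cong (Σ-antidiagonal u F)
                         (Σ-cong u (λ i i≤u → reflexive (cong (F i) (≡.sym (ℕP.+-∸-assoc 1 i≤u)))))) ⟩
    (Σ₀ u (λ m → Σ₀ m (λ i → F i (m ∸ i))) ∙ Σ₀ u (λ i → F i (suc u ∸ i))) ∙ F (suc u) 0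
      ≈⟨ assoc _ _ _ ⟩
    Σ₀ u (λ m → Σ₀ m (λ i → F i (m ∸ i))) ∙ (Σ₀ u (λ i → F i (suc u ∸ i)) ∙ F (suc u) 0) ∎

module Convolution where
  open Binomial using (ℤ-induction; binom-pascal; binom-zero)
  open InGroup ℤP.+-0-abelianGroup using (sign) renaming (Σ₀ to Σℤ) public
  open Sums ℤP.+-0-abelianGroup
  open ≡ using (refl)
  open ≡.≡-Reasoning

  -- Coefficients of (1 - x)^{-a} and of (1 - x)^q.
  negCoeff : ℤ → ℕ → ℤ
  negCoeff a i = binom (a ℤ.+ + i ℤ.- + 1) i

  posCoeff : ℤ → ℕ → ℤ
  posCoeff q s = sign s ℤ.* binom q s

  conv : (ℕ → ℤ) → (ℕ → ℤ) → ℕ → ℤ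
  conv A c m = Σℤ m (λ i → A i ℤ.* c (m ∸ i))

  conv-shift : ∀ A c e e′ m → c 0 ≡ e 0 → (∀ s → c (suc s) ≡ e (suc s) ℤ.+ e′ s) →
    conv A c (suc m) ≡ conv A e (suc m) ℤ.+ conv A e′ m
  conv-shift A c e e′ m c₀≡e₀ cₛ≡ = begin
    Σℤ m (λ i → A i ℤ.* c (suc m ∸ i)) ℤ.+ A (suc m) ℤ.* c (m ∸ m)
      ≡⟨ cong₂ ℤ._+_ (≡.trans (Σ-cong m split) (Σ-∙ m _ _)) (cong (A (suc m) ℤ.*_) last) ⟩
    (Σℤ m (λ i → A i ℤ.* e (suc m ∸ i)) ℤ.+ conv A e′ m) ℤ.+ A (suc m) ℤ.* e (m ∸ m)
      ≡⟨ ring (Σℤ m (λ i → A i ℤ.* e (suc m ∸ i))) (conv A e′ m) (A (suc m) ℤ.* e (m ∸ m)) ⟩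
    conv A e (suc m) ℤ.+ conv A e′ m ∎
    where
    split : ∀ i → i ℕ.≤ m →
      A i ℤ.* c (suc m ∸ i) ≡ A i ℤ.* e (suc m ∸ i) ℤ.+ A i ℤ.* e′ (m ∸ i)
    split i i≤m rewrite ℕP.+-∸-assoc 1 i≤m =
      ≡.trans (cong (A i ℤ.*_) (cₛ≡ (m ∸ i))) (ℤP.*-distribˡ-+ (A i) _ _)
    last : c (m ∸ m) ≡ e (m ∸ m)
    last = ≡.subst (λ j → c j ≡ e j) (≡.sym (ℕP.n∸n≡0 m)) c₀≡e₀
    ring : ∀ X Y Z → (X ℤ.+ Y) ℤ.+ Z ≡ (X ℤ.+ Z) ℤ.+ Y
    ring = solve-∀

  conv-posCoeff-zero : ∀ A m → conv A (posCoeff (+ 0)) m ≡ A m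
  conv-posCoeff-zero A zero    = ℤP.*-identityʳ (A 0)
  conv-posCoeff-zero A (suc m) rewrite ℕP.n∸n≡0 m = begin
    Σℤ m (λ i → A i ℤ.* posCoeff (+ 0) (suc m ∸ i)) ℤ.+ A (suc m) ℤ.* + 1
      ≡⟨ cong₂ ℤ._+_ (Σ-ε m vanish) (ℤP.*-identityʳ (A (suc m))) ⟩
    + 0 ℤ.+ A (suc m)
      ≡⟨ ℤP.+-identityˡ (A (suc m)) ⟩
    A (suc m) ∎
    where
    vanish : ∀ i → i ℕ.≤ m → A i ℤ.* posCoeff (+ 0) (suc m ∸ i) ≡ + 0
    vanish i i≤m rewrite ℕP.+-∸-assoc 1 i≤m | binom-zero (m ∸ i)
                       | ℤP.*-zeroʳ (sign (suc (m ∸ i))) = ℤP.*-zeroʳ (A i)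

  Recurrent : (ℤ → ℕ → ℤ) → Set
  Recurrent R = ∀ q m → R q (suc m) ≡ R (ℤ.suc q) (suc m) ℤ.+ R q m

  recurrence-unique : ∀ F G → Recurrent F → Recurrent G →
    (∀ q → F q 0 ≡ G q 0) → (∀ m → F (+ 0) m ≡ G (+ 0) m) → ∀ q m → F q m ≡ G q m
  recurrence-unique F G recF recG initial base =
    ℤ-induction (λ q → ∀ m → F q m ≡ G q m) base up down
    where
    solve-left : ∀ {x y z} → x ≡ y ℤ.+ z → y ≡ x ℤ.- z
    solve-left {y = y} {z} refl = ≡.sym (ring y z)
      where
      ring : ∀ y z → y ℤ.+ z ℤ.- z ≡ y
      ring = solve-∀
    up : ∀ q → (∀ m → F q m ≡ G q m) → ∀ m → F (ℤ.suc q) m ≡ G (ℤ.suc q) m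
    up q F≡G zero    = initial (ℤ.suc q)
    up q F≡G (suc m) = begin
      F (ℤ.suc q) (suc m)        ≡⟨ solve-left (recF q m) ⟩
      F q (suc m) ℤ.- F q m      ≡⟨ cong₂ ℤ._-_ (F≡G (suc m)) (F≡G m) ⟩
      G q (suc m) ℤ.- G q m      ≡⟨ ≡.sym (solve-left (recG q m)) ⟩
      G (ℤ.suc q) (suc m)        ∎
    down : ∀ q → (∀ m → F (ℤ.suc q) m ≡ G (ℤ.suc q) m) → ∀ m → F q m ≡ G q m
    down q F≡G zero    = initial q
    down q F≡G (suc m) = begin
      F q (suc m)                          ≡⟨ recF q m ⟩
      F (ℤ.suc q) (suc m) ℤ.+ F q m        ≡⟨ cong₂ ℤ._+_ (F≡G (suc m)) (down q F≡G m) ⟩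
      G (ℤ.suc q) (suc m) ℤ.+ G q m        ≡⟨ ≡.sym (recG q m) ⟩
      G q (suc m)                          ∎

  posCoeff-recurrent : ∀ q s → posCoeff q (suc s) ≡ posCoeff (ℤ.suc q) (suc s) ℤ.+ posCoeff q s
  posCoeff-recurrent q s =
    ≡.trans (ring (sign s) (binom q (suc s)) (binom q s))
            (cong (λ z → ℤ.- sign s ℤ.* z ℤ.+ posCoeff q s) (≡.sym (binom-pascal q s)))
    where
    ring : ∀ σ B₁ B₀ → (ℤ.- σ) ℤ.* B₁ ≡ (ℤ.- σ) ℤ.* (B₁ ℤ.+ B₀) ℤ.+ σ ℤ.* B₀
    ring = solve-∀

  conv-recurrent : ∀ a → Recurrent (λ q → conv (negCoeff a) (posCoeff q))
  conv-recurrent a q m =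
    conv-shift (negCoeff a) (posCoeff q) (posCoeff (ℤ.suc q)) (posCoeff q) m
               refl (posCoeff-recurrent q)

  closed-recurrent : ∀ a → Recurrent (λ q m → binom (a ℤ.- q ℤ.+ + m ℤ.- + 1) m)
  closed-recurrent a q m = begin
    binom (a ℤ.- q ℤ.+ + suc m ℤ.- + 1) (suc m)
      ≡⟨ cong (λ z → binom z (suc m)) (ring₁ a q (+ m)) ⟩
    binom (ℤ.suc (a ℤ.- q ℤ.+ + m ℤ.- + 1)) (suc m)
      ≡⟨ binom-pascal _ m ⟩
    binom (a ℤ.- q ℤ.+ + m ℤ.- + 1) (suc m) ℤ.+ binom (a ℤ.- q ℤ.+ + m ℤ.- + 1) m
      ≡⟨ cong (λ z → binom z (suc m) ℤ.+ binom (a ℤ.- q ℤ.+ + m ℤ.- + 1) m) (ring₂ a q (+ m)) ⟩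
    binom (a ℤ.- ℤ.suc q ℤ.+ + suc m ℤ.- + 1) (suc m) ℤ.+ binom (a ℤ.- q ℤ.+ + m ℤ.- + 1) m ∎
    where
    ring₁ : ∀ a q m → a ℤ.- q ℤ.+ (+ 1 ℤ.+ m) ℤ.- + 1 ≡ + 1 ℤ.+ (a ℤ.- q ℤ.+ m ℤ.- + 1)
    ring₁ = solve-∀
    ring₂ : ∀ a q m → a ℤ.- q ℤ.+ m ℤ.- + 1 ≡ a ℤ.- (+ 1 ℤ.+ q) ℤ.+ (+ 1 ℤ.+ m) ℤ.- + 1
    ring₂ = solve-∀

  vandermonde : ∀ a q m → conv (negCoeff a) (posCoeff q) m ≡ binom (a ℤ.- q ℤ.+ + m ℤ.- + 1) m
  vandermonde a = recurrence-unique _ _ (conv-recurrent a) (closed-recurrent a) (λ _ → refl)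
    (λ m → ≡.trans (conv-posCoeff-zero (negCoeff a) m)
                   (cong (λ z → binom z m) (ring a (+ m))))
    where
    ring : ∀ a m → a ℤ.+ m ℤ.- + 1 ≡ a ℤ.- + 0 ℤ.+ m ℤ.- + 1
    ring = solve-∀

module Multiples {c ℓ} (G : AbelianGroup c ℓ) where
  open AbelianGroup G
  open InGroup G
  open Convolution using (Σℤ)
  open SetoidReasoning setoid
  private
    module MM = MonoidMult monoid
    module CM = CommutativeMonoidMult commutativeMonoid
    module AG = AbelianGroupProperties G
    module GP = GroupProperties group
    module CS = CommutativeSemigroupProperties commutativeSemigroup

  _⋆_ : ℕ → Carrier → Carrier
  n ⋆ x = RawMonoid._×_ rawMonoid n x

  ⋆-⁻¹ : ∀ n x → n ⋆ (x ⁻¹) ≈ (n ⋆ x) ⁻¹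
  ⋆-⁻¹ zero    x = sym GP.ε⁻¹≈ε
  ⋆-⁻¹ (suc n) x = trans (∙-congˡ (⋆-⁻¹ n x)) (AG.⁻¹-∙-comm x (n ⋆ x))

  ·-neg : ∀ z x → (ℤ.- z) · x ≈ (z · x) ⁻¹
  ·-neg (+ zero)  x = sym GP.ε⁻¹≈ε
  ·-neg (+ suc n) x = refl
  ·-neg -[1+ n ]  x = sym (GP.⁻¹-involutive _)

  ⊖-· : ∀ a b x → (a ℤ.⊖ b) · x ≈ a ⋆ x ∙ (b ⋆ x) ⁻¹
  ⊖-· a zero x = begin
    (a ℤ.⊖ 0) · x   ≈⟨ reflexive (cong (_· x) (ℤP.⊖-≥ {a} {0} ℕ.z≤n)) ⟩
    a ⋆ x           ≈⟨ sym (identityʳ _) ⟩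
    a ⋆ x ∙ ε       ≈⟨ ∙-congˡ (sym GP.ε⁻¹≈ε) ⟩
    a ⋆ x ∙ ε ⁻¹    ∎
  ⊖-· zero    (suc b) x = sym (identityˡ _)
  ⊖-· (suc a) (suc b) x = begin
    (suc a ℤ.⊖ suc b) · x                  ≈⟨ reflexive (cong (_· x) (ℤP.[1+m]⊖[1+n]≡m⊖n a b)) ⟩
    (a ℤ.⊖ b) · x                          ≈⟨ ⊖-· a b x ⟩
    a ⋆ x ∙ (b ⋆ x) ⁻¹                     ≈⟨ sym (identityˡ _) ⟩
    ε ∙ (a ⋆ x ∙ (b ⋆ x) ⁻¹)               ≈⟨ ∙-congʳ (sym (inverseʳ x)) ⟩
    (x ∙ x ⁻¹) ∙ (a ⋆ x ∙ (b ⋆ x) ⁻¹)      ≈⟨ CS.interchange x (x ⁻¹) (a ⋆ x) ((b ⋆ x) ⁻¹) ⟩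
    (x ∙ a ⋆ x) ∙ (x ⁻¹ ∙ (b ⋆ x) ⁻¹)      ≈⟨ ∙-congˡ (AG.⁻¹-∙-comm x (b ⋆ x)) ⟩
    (x ∙ a ⋆ x) ∙ (x ∙ b ⋆ x) ⁻¹           ∎

  ·-+ : ∀ z w x → (z ℤ.+ w) · x ≈ z · x ∙ w · x
  ·-+ (+ m)    (+ n)    x = MM.×-homo-+ x m n
  ·-+ (+ m)    -[1+ n ] x = ⊖-· m (suc n) x
  ·-+ -[1+ m ] (+ n)    x = trans (⊖-· n (suc m) x) (comm _ _)
  ·-+ -[1+ m ] -[1+ n ] x = begin
    (suc (suc (m ℕ.+ n)) ⋆ x) ⁻¹    ≈⟨ ⁻¹-cong (MM.×-congˡ (≡.sym (ℕP.+-suc (suc m) n))) ⟩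
    ((suc m ℕ.+ suc n) ⋆ x) ⁻¹      ≈⟨ ⁻¹-cong (MM.×-homo-+ x (suc m) (suc n)) ⟩
    (suc m ⋆ x ∙ suc n ⋆ x) ⁻¹      ≈⟨ sym (AG.⁻¹-∙-comm _ _) ⟩
    (suc m ⋆ x) ⁻¹ ∙ (suc n ⋆ x) ⁻¹ ∎

  ·-*-pos : ∀ m w x → (+ m ℤ.* w) · x ≈ m ⋆ (w · x)
  ·-*-pos m (+ n)    x = trans (reflexive (cong (_· x) (≡.sym (ℤP.pos-* m n))))
                               (sym (MM.×-assocˡ x m n))
  ·-*-pos m -[1+ n ] x = begin
    (+ m ℤ.* -[1+ n ]) · x         ≈⟨ reflexive (cong (_· x) (≡.sym (ℤP.neg-distribʳ-* (+ m) (+ suc n)))) ⟩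
    (ℤ.- (+ m ℤ.* + suc n)) · x    ≈⟨ ·-neg (+ m ℤ.* + suc n) x ⟩
    ((+ m ℤ.* + suc n) · x) ⁻¹     ≈⟨ ⁻¹-cong (reflexive (cong (_· x) (≡.sym (ℤP.pos-* m (suc n))))) ⟩
    ((m ℕ.* suc n) ⋆ x) ⁻¹         ≈⟨ ⁻¹-cong (sym (MM.×-assocˡ x m (suc n))) ⟩
    (m ⋆ (suc n ⋆ x)) ⁻¹           ≈⟨ sym (⋆-⁻¹ m _) ⟩
    m ⋆ ((suc n ⋆ x) ⁻¹)           ∎

  ·-* : ∀ z w x → (z ℤ.* w) · x ≈ z · (w · x)
  ·-* (+ m)    w x = ·-*-pos m w x
  ·-* -[1+ m ] w x = begin
    (-[1+ m ] ℤ.* w) · x        ≈⟨ reflexive (cong (_· x) (≡.sym (ℤP.neg-distribˡ-* (+ suc m) w))) ⟩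
    (ℤ.- (+ suc m ℤ.* w)) · x   ≈⟨ ·-neg (+ suc m ℤ.* w) x ⟩
    ((+ suc m ℤ.* w) · x) ⁻¹    ≈⟨ ⁻¹-cong (·-*-pos (suc m) w x) ⟩
    (suc m ⋆ (w · x)) ⁻¹        ∎

  ·-∙ : ∀ z x y → z · (x ∙ y) ≈ z · x ∙ z · y
  ·-∙ (+ n)    x y = CM.×-distrib-+ x y n
  ·-∙ -[1+ n ] x y = trans (⁻¹-cong (CM.×-distrib-+ x y (suc n))) (sym (AG.⁻¹-∙-comm _ _))

  ·-Σ : ∀ z u (f : ℕ → Carrier) → z · Σ₀ u f ≈ Σ₀ u (λ i → z · f i)
  ·-Σ z zero    f = refl
  ·-Σ z (suc u) f = trans (·-∙ z _ _) (∙-congʳ (·-Σ z u f))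

  Σ-· : ∀ u (d : ℕ → ℤ) x → Σ₀ u (λ i → d i · x) ≈ Σℤ u d · x
  Σ-· zero    d x = refl
  Σ-· (suc u) d x = trans (∙-congʳ (Σ-· u d x)) (sym (·-+ (Σℤ u d) (d (suc u)) x))

-- The double-sum identity behind Lemma 5.5, in any abelian group: an
-- inner alternating sum with binomials C(Q, s), where Q depends only on the
-- position u' - s of h, collapses against the outer weights C(a+i-1, i).
-- Both parts of the lemma are instances of it.
module Collapse {c ℓ} (G : AbelianGroup c ℓ) where
  open AbelianGroup G
  open InGroup G
  open Sums G
  open Multiples G
  open Convolution using (negCoeff; posCoeff; conv; vandermonde)
  open SetoidReasoning setoid

  -- the sign sequence is the same whichever group it is declared in
  sign-agrees : ∀ s → sign s ≡ Convolution.sign s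
  sign-agrees zero    = ≡.refl
  sign-agrees (suc s) = cong ℤ.-_ (sign-agrees s)

  collapse : (h : ℕ → Carrier) (Q : ℕ → ℕ → ℤ) (q : ℕ → ℤ) →
    (∀ u′ s → s ℕ.≤ u′ → Q u′ s ≡ q (u′ ∸ s)) → (a : ℤ) (u : ℕ) →
    Σ₀ u (λ i → negCoeff a i
                · Σ₀ (u ∸ i) (λ s → (sign s ℤ.* binom (Q (u ∸ i) s) s) · h (u ∸ i ∸ s)))
    ≈ Σ₀ u (λ m → binom (a ℤ.- q (u ∸ m) ℤ.+ + m ℤ.- + 1) m · h (u ∸ m))
  collapse h Q q Q≡q a u = begin
    Σ₀ u (λ i → negCoeff a i · Σ₀ (u ∸ i) (λ s → term i s))
      ≈⟨ Σ-cong u (λ i _ → ·-Σ (negCoeff a i) (u ∸ i) _) ⟩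
    Σ₀ u (λ i → Σ₀ (u ∸ i) (λ s → negCoeff a i · term i s))
      ≈⟨ Σ-antidiagonal u (λ i s → negCoeff a i · term i s) ⟩
    Σ₀ u (λ m → Σ₀ m (λ i → negCoeff a i · term i (m ∸ i)))
      ≈⟨ Σ-cong u (λ m m≤u → Σ-cong m (λ i i≤m → regroup m i m≤u i≤m)) ⟩
    Σ₀ u (λ m → Σ₀ m (λ i → (negCoeff a i ℤ.* posCoeff (q (u ∸ m)) (m ∸ i)) · h (u ∸ m)))
      ≈⟨ Σ-cong u (λ m _ → Σ-· m _ (h (u ∸ m))) ⟩
    Σ₀ u (λ m → conv (negCoeff a) (posCoeff (q (u ∸ m))) m · h (u ∸ m))
      ≈⟨ Σ-cong u (λ m _ → reflexive (cong (_· h (u ∸ m)) (vandermonde a (q (u ∸ m)) m))) ⟩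
    Σ₀ u (λ m → binom (a ℤ.- q (u ∸ m) ℤ.+ + m ℤ.- + 1) m · h (u ∸ m)) ∎
    where
    term : ℕ → ℕ → Carrier
    term i s = (sign s ℤ.* binom (Q (u ∸ i) s) s) · h (u ∸ i ∸ s)
    regroup : ∀ m i → m ℕ.≤ u → i ℕ.≤ m →
      negCoeff a i · term i (m ∸ i) ≈ (negCoeff a i ℤ.* posCoeff (q (u ∸ m)) (m ∸ i)) · h (u ∸ m)
    regroup m i m≤u i≤m = trans (sym (·-* (negCoeff a i) _ _))
      (reflexive (cong₂ (λ z j → (negCoeff a i ℤ.* z) · h j) coefficient (∸-∸-cancel u i≤m)))
      where
      coefficient : sign (m ∸ i) ℤ.* binom (Q (u ∸ i) (m ∸ i)) (m ∸ i) ≡ posCoeff (q (u ∸ m)) (m ∸ i)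
      coefficient = cong₂ (λ σ z → σ ℤ.* binom z (m ∸ i)) (sign-agrees (m ∸ i))
        (≡.trans (Q≡q (u ∸ i) (m ∸ i) (ℕP.∸-monoˡ-≤ i m≤u)) (cong q (∸-∸-cancel u i≤m)))

  -- Part (1): the inner binomials C(p, s) do not depend on the position.
  T-identity : (g : List ℕ → Carrier) (ν : List ℕ) (u : ℕ) (p n : ℤ) →
    Σ₀ u (λ i → binom (p ℤ.+ n ℤ.+ + i ℤ.- + 1) i · T g ν (u ∸ i) p)
      ≈ Σ₀ u (λ s → binom (n ℤ.+ + s ℤ.- + 1) s · g (ν ∪ ⟨ u ∸ s ⟩))
  T-identity g ν u p n =
    trans (collapse (λ j → g (ν ∪ ⟨ j ⟩)) (λ _ _ → p) (λ _ → p) (λ _ _ _ → ≡.refl) (p ℤ.+ n) u)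
      (Σ-cong u (λ m _ → reflexive (cong (λ z → binom z m · g (ν ∪ ⟨ u ∸ m ⟩)) (ring p n (+ m)))))
    where
    ring : ∀ p n m → p ℤ.+ n ℤ.- p ℤ.+ m ℤ.- + 1 ≡ n ℤ.+ m ℤ.- + 1
    ring = solve-∀

  -- Part (2): the inner binomials C(p + α_{u'+1-s}, s) depend only on the
  -- position u' - s.
  T′-identity : (g : List ℕ → Carrier) (k : ℕ) (ts : List (ℕ × ℕ)) (ν : List ℕ) (u : ℕ) (p n : ℤ) →
    Σ₀ u (λ i → binom (p ℤ.+ n ℤ.+ + i ℤ.- + 1) i · T′ g k ts ν (u ∸ i) p)
      ≈ Σ₀ u (λ s → binom (n ℤ.- + α ts (suc u ∸ s) ℤ.+ + s ℤ.- + 1) s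
                      · g ((Pof k ts ∪ ν) ∪ ⟨ u ∸ s ⟩))
  T′-identity g k ts ν u p n =
    trans (collapse (λ j → g ((Pof k ts ∪ ν) ∪ ⟨ j ⟩)) (λ u′ s → p ℤ.+ + α ts (suc u′ ∸ s))
                    (λ j → p ℤ.+ + α ts (suc j))
                    (λ u′ s s≤u′ → cong (λ j → p ℤ.+ + α ts j) (ℕP.+-∸-assoc 1 s≤u′)) (p ℤ.+ n) u)
      (Σ-cong u (λ m m≤u → reflexive (cong (λ z → binom z m · g ((Pof k ts ∪ ν) ∪ ⟨ u ∸ m ⟩))
        (≡.trans (ring p n (+ α ts (suc (u ∸ m))) (+ m))
                 (cong (λ j → n ℤ.- + α ts j ℤ.+ + m ℤ.- + 1) (≡.sym (ℕP.+-∸-assoc 1 m≤u)))))))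
    where
    ring : ∀ p n A m → p ℤ.+ n ℤ.- (p ℤ.+ A) ℤ.+ m ℤ.- + 1 ≡ n ℤ.- A ℤ.+ m ℤ.- + 1
    ring = solve-∀

-- Lemma 5.5.
lemma5p5 : ∀ {c ℓ} (G : AbelianGroup c ℓ) →
  let open AbelianGroup G
      open InGroup G
  in (k : ℕ) → 1 ℕ.≤ k → (g : List ℕ → Carrier) →
     (ν : List ℕ) → IsPartition ν → 1 ℕ.≤ length ν →
     ν ⊂ R k (suc k ∸ length ν) →
     (u : ℕ) → u ℕ.≤ lastPart ν → (p n : ℤ) →
     (Σ₀ u (λ i → binom (p ℤ.+ n ℤ.+ + i ℤ.- + 1) i · T g ν (u ∸ i) p)
        ≈ Σ₀ u (λ s → binom (n ℤ.+ + s ℤ.- + 1) s · g (ν ∪ ⟨ u ∸ s ⟩)))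
     ×
     ((ts : List (ℕ × ℕ)) → 1 ℕ.≤ length ts →
      All (λ ta → 1 ℕ.≤ proj₁ ta × proj₁ ta ℕ.≤ k × 1 ℕ.≤ proj₂ ta) ts →
      Unique (map proj₁ ts) →
      Σ₀ u (λ i → binom (p ℤ.+ n ℤ.+ + i ℤ.- + 1) i · T′ g k ts ν (u ∸ i) p)
        ≈ Σ₀ u (λ s → binom (n ℤ.- + α ts (suc u ∸ s) ℤ.+ + s ℤ.- + 1) s
                        · g ((Pof k ts ∪ ν) ∪ ⟨ u ∸ s ⟩)))
lemma5p5 G k _ g ν _ _ _ u _ p n =
  T-identity g ν u p n , λ ts _ _ _ → T′-identity g k ts ν u p n
  where open Collapse G
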